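{- For all integers $n,j$ with $0\le j\le n$, the number $T(n,j)=\frac{1}{2n+1}\binom{2n+j}{j}\binom{2n+1}{n+j+1}$ is an integer. Moreover, if $n\ge 1$, then \[ T(n,j)=\frac{1}{n}\binom{n}{j}\binom{2n+j}{n-1}. \] -}

module Defs where

{-# OPTIONS --safe #-}
-- Expanding the four binomials into factorials gives (2n+1)·E = n·B for n ≥ 1, where
-- E = C(n,j)·C(2n+j,n−1) and B = C(2n+j,j)·C(2n+1,n+j+1). Because 2n+1 ≡ 1 (mod n), such a
-- cross identity has the explicit common quotient T = B − 2E:
-- (2n+1)T = (2n+1)B − 2nB = B and nT = (2n+1)E − 2nE = E.
module Submission where

open import Defs
open import Data.Nat using (ℕ; zero; suc; _+_; _*_; _∸_; _≤_; z≤n; _!; NonZero)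
open import Data.Nat.Combinatorics using (_C_; k![n∸k]!∣n!)
open import Data.Product using (Σ; _×_; _,_)
open import Relation.Binary.PropositionalEquality
  using (_≡_; refl; sym; trans; cong; cong₂; subst; module ≡-Reasoning)

open import Data.Nat.Properties
open import Data.Nat.DivMod using (m/n*n≡m)
open import Data.Nat.Combinatorics.Specification using (nCk≡n!/k![n-k]!)
open import Data.Nat.Tactic.RingSolver using (solve-∀; solve)
open import Data.List.Base using (_∷_; [])

nCk*[k!*r!]≡n! : ∀ k r {n} → k + r ≡ n → (n C k) * (k ! * r !) ≡ n !
nCk*[k!*r!]≡n! k r {n} k+r≡n = begin
  (n C k) * (k ! * r !)        ≡⟨ cong (λ s → (n C k) * (k ! * s !)) r≡n∸k ⟩
  (n C k) * (k ! * (n ∸ k) !)  ≡⟨ cong (_* (k ! * (n ∸ k) !)) (nCk≡n!/k![n-k]! k≤n) ⟩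
  _                            ≡⟨ m/n*n≡m {{k !* (n ∸ k) !≢0}} (k![n∸k]!∣n! k≤n) ⟩
  n !                          ∎
  where
  open ≡-Reasoning
  k≤n : k ≤ n
  k≤n = subst (k ≤_) k+r≡n (m≤m+n k r)
  r≡n∸k : r ≡ n ∸ k
  r≡n∸k = trans (sym (m+n∸m≡n k r)) (cong (_∸ k) k+r≡n)

cross-multiple⇒common-quotient : ∀ k n e b → (k * n + 1) * e ≡ n * b →
  (k * n + 1) * (b ∸ k * e) ≡ b × n * (b ∸ k * e) ≡ e
cross-multiple⇒common-quotient k n e b [kn+1]e≡nb = [kn+1][b∸ke]≡b , n[b∸ke]≡e
  where
  open ≡-Reasoning
  [kn+1]b≡k[nb]+b : (k * n + 1) * b ≡ k * (n * b) + b
  [kn+1]b≡k[nb]+b = solve (k ∷ n ∷ b ∷ [])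
  [kn+1]ke≡k[nb] : (k * n + 1) * (k * e) ≡ k * (n * b)
  [kn+1]ke≡k[nb] = begin
    (k * n + 1) * (k * e)    ≡⟨ solve (k ∷ n ∷ e ∷ []) ⟩
    k * ((k * n + 1) * e)    ≡⟨ cong (k *_) [kn+1]e≡nb ⟩
    k * (n * b)              ∎
  nb≡n[ke]+e : n * b ≡ n * (k * e) + e
  nb≡n[ke]+e = begin
    n * b                    ≡⟨ [kn+1]e≡nb ⟨
    (k * n + 1) * e          ≡⟨ solve (k ∷ n ∷ e ∷ []) ⟩
    n * (k * e) + e          ∎

  [kn+1][b∸ke]≡b : (k * n + 1) * (b ∸ k * e) ≡ b
  [kn+1][b∸ke]≡b = begin
    (k * n + 1) * (b ∸ k * e)                ≡⟨ *-distribˡ-∸ (k * n + 1) b (k * e) ⟩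
    (k * n + 1) * b ∸ (k * n + 1) * (k * e)  ≡⟨ cong₂ _∸_ [kn+1]b≡k[nb]+b [kn+1]ke≡k[nb] ⟩
    k * (n * b) + b ∸ k * (n * b)            ≡⟨ m+n∸m≡n (k * (n * b)) b ⟩
    b                                        ∎
  n[b∸ke]≡e : n * (b ∸ k * e) ≡ e
  n[b∸ke]≡e = begin
    n * (b ∸ k * e)                          ≡⟨ *-distribˡ-∸ n b (k * e) ⟩
    n * b ∸ n * (k * e)                      ≡⟨ cong (_∸ n * (k * e)) nb≡n[ke]+e ⟩
    n * (k * e) + e ∸ n * (k * e)            ≡⟨ m+n∸m≡n (n * (k * e)) e ⟩
    e                                        ∎

binomial-cross-identity : ∀ m j → j ≤ suc m →
  (2 * suc m + 1) * ((suc m C j) * ((2 * suc m + j) C m)) ≡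
  suc m * (((2 * suc m + j) C j) * ((2 * suc m + 1) C (suc m + j + 1)))
binomial-cross-identity m j j≤n = *-cancelʳ-≡ _ _ D {{D≢0}} (begin
  N * (a * b) * D
    ≡⟨ regroupˡ N a b J R M Q F ⟩
  (N * F) * (a * (J * R)) * (b * (M * Q))
    ≡⟨ cong₂ _*_ (cong₂ _*_ N*[2n]!≡N! a*[j!*r!]≡n!) b*[m!*q!]≡[2n+j]! ⟩
  N ! * n ! * (2 * n + j) !
    ≡⟨ cong₂ _*_ (cong₂ _*_ d*[q!*r!]≡N! refl) c*[j!*[2n]!]≡[2n+j]! ⟨
  (d * (Q * R)) * (n * M) * (c * (J * F))
    ≡⟨ regroupʳ n c d J R M Q F ⟨
  n * (c * d) * D
    ∎)
  where
  open ≡-Reasoning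
  n N q r a b c d J R M Q F D : ℕ
  n = suc m
  N = 2 * n + 1
  q = n + j + 1
  r = n ∸ j
  a = n C j
  b = (2 * n + j) C m
  c = (2 * n + j) C j
  d = N C q
  J = j !
  R = r !
  M = m !
  Q = q !
  F = (2 * n) !
  D = J * R * M * Q * F

  D≢0 : NonZero D
  D≢0 = m*n≢0 (J * R * M * Q) F
    {{m*n≢0 (J * R * M) Q {{m*n≢0 (J * R) M {{j !* r !≢0}} {{m !≢0}}}} {{q !≢0}}}}
    {{(2 * n) !≢0}}

  regroupˡ : ∀ N a b J R M Q F →
    N * (a * b) * (J * R * M * Q * F) ≡ (N * F) * (a * (J * R)) * (b * (M * Q))
  regroupˡ = solve-∀
  regroupʳ : ∀ n c d J R M Q F →
    n * (c * d) * (J * R * M * Q * F) ≡ (d * (Q * R)) * (n * M) * (c * (J * F))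
  regroupʳ = solve-∀

  j+r≡n : j + r ≡ n
  j+r≡n = m+[n∸m]≡n j≤n

  N*[2n]!≡N! : N * F ≡ N !
  N*[2n]!≡N! = trans (cong (_* F) (+-comm (2 * n) 1)) (cong _! (+-comm 1 (2 * n)))
  a*[j!*r!]≡n! : a * (J * R) ≡ n !
  a*[j!*r!]≡n! = nCk*[k!*r!]≡n! j r j+r≡n
  b*[m!*q!]≡[2n+j]! : b * (M * Q) ≡ (2 * n + j) !
  b*[m!*q!]≡[2n+j]! = nCk*[k!*r!]≡n! m q (m+q≡2n+j m j)
    where
    m+q≡2n+j : ∀ m j → m + (suc m + j + 1) ≡ 2 * suc m + j
    m+q≡2n+j = solve-∀
  c*[j!*[2n]!]≡[2n+j]! : c * (J * F) ≡ (2 * n + j) !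
  c*[j!*[2n]!]≡[2n+j]! = nCk*[k!*r!]≡n! j (2 * n) (+-comm j (2 * n))
  d*[q!*r!]≡N! : d * (Q * R) ≡ N !
  d*[q!*r!]≡N! = nCk*[k!*r!]≡n! q r (q+r≡2n+1 j+r≡n)
    where
    q+r≡2n+1 : ∀ {n j r} → j + r ≡ n → n + j + 1 + r ≡ 2 * n + 1
    q+r≡2n+1 {j = j} {r} refl = solve (j ∷ r ∷ [])

proposition1 : (n j : ℕ) → j ≤ n →
    Σ ℕ (λ T → ((2 * n + 1) * T ≡ ((2 * n + j) C j) * ((2 * n + 1) C (n + j + 1)))
    × (1 ≤ n → n * T ≡ (n C j) * ((2 * n + j) C (n ∸ 1))))
proposition1 zero    zero z≤n = 1 , refl , λ ()
proposition1 (suc m) j j≤n =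
  let [2n+1]T≡B , nT≡E =
        cross-multiple⇒common-quotient 2 (suc m) E B (binomial-cross-identity m j j≤n)
  in  B ∸ 2 * E , [2n+1]T≡B , λ _ → nT≡E
  where
  E B : ℕ
  E = (suc m C j) * ((2 * suc m + j) C m)
  B = ((2 * suc m + j) C j) * ((2 * suc m + 1) C (suc m + j + 1))
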